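{- Let $\pi$ be a permutation whose normalization has the form $r\,\mu\,(r+1)(r+2)\cdots n$ for some nonempty permutation $\mu\in S_{r-1}$, and let $\overrightarrow\pi$ be the permutation with the same set of entries as $\pi$ whose normalization is $\mu\,r\,(r+1)(r+2)\cdots n$. Then $|s^{ -1}(\pi)|\le|s^{ -1}(\overrightarrow\pi)|$.
   Context: A permutation is an ordering of a finite set of integers in one-line notation; $S_k$ is the set of permutations of $[k]$. The normalization of a permutation with $n$ entries is the permutation in $S_n$ obtained by replacing its $i$-th smallest entry by $i$ for each $i$. The stack-sorting map $s$: $s$ of the empty permutation is empty, and if $\pi=LmR$ with $m$ the largest entry, then $s(\pi)=s(L)s(R)m$. For a permutation $\pi$, $s^{ -1}(\pi)$ is the set of permutations $\tau$ with the same set of entries as $\pi$ such that $s(\tau)=\pi$. -}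

module Defs where

open import Data.Nat using (ℕ; zero; suc; _+_; _∸_; _<ᵇ_; _⊔_)
import Data.Nat as N
open import Data.Bool using (Bool; true; false; if_then_else_)
open import Data.Product using (_×_; _,_)
open import Data.List using (List; []; _∷_; _++_; length; map; filter; concatMap; foldr)
open import Data.List.Properties using (≡-dec)
open import Relation.Binary.PropositionalEquality using (_≡_)
open import Relation.Nullary using (Dec)

-- Permutations are lists of natural numbers in one-line notation;
-- "being a permutation" = having pairwise distinct entries (Unique).

-- maximum of a list (0 for the empty list; only used on nonempty lists)
maxL : List ℕ → ℕ
maxL = foldr _⊔_ 0

splitAtElem : ℕ → List ℕ → List ℕ × List ℕ
splitAtElem m [] = [] , []
splitAtElem m (x ∷ xs) with x N.≡ᵇ m
... | true  = [] , xs
... | false with splitAtElem m xs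
...   | L , R = x ∷ L , R

-- stack-sorting map, with fuel (fuel = length suffices)
sFuel : ℕ → List ℕ → List ℕ
sFuel zero    l  = l
sFuel (suc f) [] = []
sFuel (suc f) l@(_ ∷ _) with splitAtElem (maxL l) l
... | L , R = sFuel f L ++ sFuel f R ++ (maxL l ∷ [])

s : List ℕ → List ℕ
s l = sFuel (length l) l

insertions : ℕ → List ℕ → List (List ℕ)
insertions x []       = (x ∷ []) ∷ []
insertions x (y ∷ ys) = (x ∷ y ∷ ys) ∷ map (y ∷_) (insertions x ys)

rearrangements : List ℕ → List (List ℕ)
rearrangements []       = [] ∷ []
rearrangements (x ∷ xs) = concatMap (insertions x) (rearrangements xs)

-- |s⁻¹(π)| : number of permutations τ with the same entries as π and s(τ) = π
-- (for π with distinct entries, `rearrangements π` lists each such τ exactly once)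
preimageCount : List ℕ → ℕ
preimageCount π = length (filter (λ τ → ≡-dec N._≟_ (s τ) π) (rearrangements π))

rank : List ℕ → ℕ → ℕ
rank l x = suc (length (filter (λ y → y N.<? x) l))

normalize : List ℕ → List ℕ
normalize l = map (rank l) l

range : ℕ → ℕ → List ℕ
range a zero    = []
range a (suc k) = a ∷ range (suc a) k

-- [a .. b] = a (a+1) ... b  (empty if b < a)
interval : ℕ → ℕ → List ℕ
interval a b = range a (suc b ∸ a)

module Submission where

-- Decoding the normalizations, π = x M T and π→ = M x T, where M ≠ [] holds the
-- entries below x and T those above x.  A permutation τ with s(τ) = π is the
-- inorder reading of its decreasing (Cartesian) tree, whose postorder is s(τ);
-- so s⁻¹(π) corresponds to decreasing trees with postorder x M T, and we give an
-- injective map from those to decreasing trees with postorder M x T.  The nodes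
-- above x form a frame around the root; the subtrees with labels ≤ x hanging off
-- a path of frame nodes from the root ("holes") carry x M in postorder, and they
-- are some leaves, the single node x, and trees carrying M.  Rotating the hole
-- sequence so that the node x comes after the trees carrying M gives the
-- required tree; the frame is untouched, so the rotation can be undone.

open import Defs
import Data.Nat as ℕ
open import Data.Nat
  using (ℕ; zero; suc; _≤_; _<_; _+_; _∸_; _<ᵇ_; _<?_; z≤n; s≤s)
open import Data.Nat.Properties
  using (≤-refl; ≤-trans; ≤-antisym; ≤-pred; <⇒≤; <⇒≱; ≰⇒>; ≮⇒≥; <-irrefl; ≤∧≢⇒<;
         <-≤-trans; ≤-<-trans; <-cmp; suc-injective; +-suc; +-identityʳ; m≤m+n; m≤n+m;
         ⊔-sel; ⊔-lub; ⊔-identityʳ; m≤m⊔n; m≤n⊔m; ≡ᵇ⇒≡; ≡⇒≡ᵇ; <ᵇ⇒<; <⇒<ᵇ)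
open import Data.Bool using (Bool; true; false; T)
open import Data.Bool.Properties using (T-≡)
open import Data.Unit using (⊤; tt)
open import Data.Empty using (⊥-elim)
open import Data.Product using (∃-syntax; ∃₂; _×_; _,_; proj₁; proj₂)
open import Data.Sum using (inj₁; inj₂; [_,_])
open import Data.List using (List; []; _∷_; _++_; length; map; filter; replicate)
import Data.List.Properties as List
open import Data.List.Properties using (≡-dec)
open import Data.List.Relation.Unary.All as All using (All; []; _∷_)
import Data.List.Relation.Unary.All.Properties as All
open import Data.List.Relation.Unary.Any as Any using (here; there)
open import Data.List.Relation.Unary.AllPairs using (AllPairs; []; _∷_)
open import Data.List.Relation.Unary.Unique.Propositional using (Unique)
import Data.List.Relation.Unary.Unique.Propositional.Properties as Unique
open import Data.List.Relation.Binary.Disjoint.Propositional using (Disjoint)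
open import Data.List.Membership.Propositional using (_∈_; _∉_)
open import Data.List.Membership.Propositional.Properties
  using (∈-∃++; ∈-++⁺ˡ; ∈-++⁺ʳ; ∈-++⁻; ∈-map⁺; ∈-map⁻; ∈-concat⁺′; ∈-concat⁻′; ∈-filter⁺; ∈-filter⁻)
open import Data.List.Relation.Binary.Permutation.Propositional
  using (_↭_; ↭-refl; ↭-sym; ↭-trans; ↭-prep; ↭⇒↭ₛ; module PermutationReasoning)
open import Data.List.Relation.Binary.Permutation.Propositional.Properties
  using (shift; drop-∷; ++⁺; ++-comm; All-resp-↭; ∈-resp-↭; ↭-length; ↭-empty-inv; filter-↭)
import Data.List.Relation.Binary.Permutation.Setoid.Properties as Permutationₛ
open import Data.List.Relation.Binary.Sublist.Propositional using (_⊆_; ⊆-refl)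
open import Data.List.Relation.Binary.Sublist.Propositional.Properties
  using (filter⁺; length-mono-≤; to-≋)
open import Data.List.Relation.Binary.Equality.Propositional using (≋⇒≡)
open import Function using (_∘_; Equivalence)
open import Relation.Binary using (tri<; tri≈; tri>)
open import Relation.Nullary using (Dec)
open import Relation.Binary.PropositionalEquality
  using (_≡_; _≢_; refl; sym; trans; cong; cong₂; subst; setoid; module ≡-Reasoning)

module _ {A : Set} where

  ++-∷-cancel : ∀ {v : A} xs xs′ {ys ys′} → v ∉ xs → v ∉ xs′ →
                xs ++ v ∷ ys ≡ xs′ ++ v ∷ ys′ → xs ≡ xs′ × ys ≡ ys′
  ++-∷-cancel []       []         _  _  eq = refl , List.∷-injectiveʳ eq
  ++-∷-cancel []       (x′ ∷ xs′) _  v∉ eq = ⊥-elim (v∉ (here (List.∷-injectiveˡ eq)))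
  ++-∷-cancel (x ∷ xs) []         v∉ _  eq = ⊥-elim (v∉ (here (sym (List.∷-injectiveˡ eq))))
  ++-∷-cancel (x ∷ xs) (x′ ∷ xs′) v∉ v∉′ eq with List.∷-injective eq
  ... | refl , eq′ with ++-∷-cancel xs xs′ (v∉ ∘ there) (v∉′ ∘ there) eq′
  ...   | refl , refl = refl , refl

  Unique-resp-↭ : ∀ {xs ys : List A} → xs ↭ ys → Unique xs → Unique ys
  Unique-resp-↭ p = Permutationₛ.Unique-resp-↭ (setoid A) (↭⇒↭ₛ p)

  Unique-++⁻ : ∀ (xs : List A) {ys} → Unique (xs ++ ys) → Unique xs × Unique ys
  Unique-++⁻ []       uniq          = [] , uniq
  Unique-++⁻ (x ∷ xs) (x∉ ∷ uniq) with Unique-++⁻ xs uniq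
  ... | uxs , uys = (All.++⁻ˡ xs x∉ ∷ uxs) , uys

module _ {A B : Set} where

  length-≤-by-injection : ∀ (g : A → B) {xs : List A} {ys : List B} → Unique xs →
    (∀ {t} → t ∈ xs → g t ∈ ys) →
    (∀ {t u} → t ∈ xs → u ∈ xs → g t ≡ g u → t ≡ u) →
    length xs ≤ length ys
  length-≤-by-injection g {[]}     _           _    _   = z≤n
  length-≤-by-injection g {x ∷ xs} (x∉ ∷ uniq) into inj with ∈-∃++ (into (here refl))
  ... | ys₁ , ys₂ , refl = subst (suc (length xs) ≤_) (sym (↭-length (shift (g x) ys₁ ys₂)))
    (s≤s (length-≤-by-injection g uniq into′ (λ p q → inj (there p) (there q))))
    where
    into′ : ∀ {t} → t ∈ xs → g t ∈ ys₁ ++ ys₂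
    into′ {t} t∈ with ∈-resp-↭ (shift (g x) ys₁ ys₂) (into (there t∈))
    ... | here gt≡gx = ⊥-elim (All.lookup x∉ t∈ (sym (inj (there t∈) (here refl) gt≡gx)))
    ... | there p    = p

last-∈-tail : ∀ {a v : ℕ} L P → a ∷ L ≡ P ++ v ∷ [] → L ≢ [] → v ∈ L
last-∈-tail L []      eq L≢[] = ⊥-elim (L≢[] (List.∷-injectiveʳ eq))
last-∈-tail L (p ∷ P) eq _ with refl ← List.∷-injectiveʳ eq = ∈-++⁺ʳ P (here refl)

split-at-threshold : ∀ {x b : ℕ} {B D} A C → All (_≤ x) A → All (_≤ x) C → x < b → All (x <_) D →
                     A ++ b ∷ B ≡ C ++ D → A ≡ C × b ∷ B ≡ D
split-at-threshold []      []      _ _ _ _ eq = refl , eq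
split-at-threshold []      (c ∷ C) _ (c≤x ∷ _) x<b _ eq with refl ← List.∷-injectiveˡ eq =
  ⊥-elim (<⇒≱ x<b c≤x)
split-at-threshold (a ∷ A) []      (a≤x ∷ _) _ _ (x<a ∷ _) refl = ⊥-elim (<⇒≱ x<a a≤x)
split-at-threshold (a ∷ A) (c ∷ C) (_ ∷ A≤x) (_ ∷ C≤x) x<b D>x eq with List.∷-injective eq
... | refl , eq′ with split-at-threshold A C A≤x C≤x x<b D>x eq′
...   | refl , rest = refl , rest

map-injective-on : ∀ {A B : Set} (f : A → B) {S : List A} →
  (∀ {y z} → y ∈ S → z ∈ S → f y ≡ f z → y ≡ z) →
  ∀ {xs ys} → All (_∈ S) xs → All (_∈ S) ys → map f xs ≡ map f ys → xs ≡ ys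
map-injective-on f inj {[]}     {[]}     _          _          _  = refl
map-injective-on f inj {x ∷ xs} {y ∷ ys} (x∈ ∷ xs⊆) (y∈ ∷ ys⊆) eq with fx≡fy , eq′ ← List.∷-injective eq =
  cong₂ _∷_ (inj x∈ y∈ fx≡fy) (map-injective-on f inj xs⊆ ys⊆ eq′)

map-++-split : ∀ {A B : Set} (f : A → B) μ {ν} xs → map f xs ≡ μ ++ ν →
  ∃₂ λ ys zs → xs ≡ ys ++ zs × map f ys ≡ μ × map f zs ≡ ν
map-++-split f []      xs       eq = [] , xs , refl , refl , eq
map-++-split f (m ∷ μ) (x ∷ xs) eq with fx≡m , eq′ ← List.∷-injective eq
  with ys , zs , refl , ys≡ , zs≡ ← map-++-split f μ xs eq′ =
  x ∷ ys , zs , refl , cong₂ _∷_ fx≡m ys≡ , zs≡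

insertion-form : ∀ {x τ} ys → τ ∈ insertions x ys →
                 ∃₂ λ A C → ys ≡ A ++ C × τ ≡ A ++ x ∷ C
insertion-form []       (here refl) = [] , [] , refl , refl
insertion-form (y ∷ ys) (here refl) = [] , y ∷ ys , refl , refl
insertion-form (y ∷ ys) (there p) with ∈-map⁻ (y ∷_) p
... | τ , τ∈ , refl with insertion-form ys τ∈
...   | A , C , refl , refl = y ∷ A , C , refl , refl

∈-insertions : ∀ {x} A C → A ++ x ∷ C ∈ insertions x (A ++ C)
∈-insertions []      []      = here refl
∈-insertions []      (c ∷ C) = here refl
∈-insertions (a ∷ A) C       = there (∈-map⁺ (a ∷_) (∈-insertions A C))

rearrangement⇒↭ : ∀ {τ} l → τ ∈ rearrangements l → τ ↭ l
rearrangement⇒↭ []       (here refl) = ↭-refl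
rearrangement⇒↭ (x ∷ xs) p with ∈-concat⁻′ (map (insertions x) (rearrangements xs)) p
... | _ , τ∈ins , ins∈ with ∈-map⁻ (insertions x) ins∈
...   | ys , ys∈ , refl with insertion-form ys τ∈ins
...     | A , C , refl , refl = ↭-trans (shift x A C) (↭-prep x (rearrangement⇒↭ xs ys∈))

↭⇒rearrangement : ∀ {τ} l → τ ↭ l → τ ∈ rearrangements l
↭⇒rearrangement []       p with ↭-empty-inv p
... | refl = here refl
↭⇒rearrangement (x ∷ xs) p with ∈-∃++ (∈-resp-↭ (↭-sym p) (here refl))
... | A , C , refl = ∈-concat⁺′ (∈-insertions A C)
  (∈-map⁺ (insertions x) (↭⇒rearrangement xs (drop-∷ (↭-trans (↭-sym (shift x A C)) p))))

insertions-unique : ∀ {x} ys → x ∉ ys → Unique (insertions x ys)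
insertions-unique []       _  = [] ∷ []
insertions-unique {x} (y ∷ ys) x∉ =
  All.tabulate head-new ∷ Unique.map⁺ List.∷-injectiveʳ (insertions-unique ys (x∉ ∘ there))
  where
  head-new : ∀ {τ} → τ ∈ map (y ∷_) (insertions x ys) → x ∷ y ∷ ys ≢ τ
  head-new p eq with ∈-map⁻ (y ∷_) p
  ... | _ , _ , refl = x∉ (here (List.∷-injectiveˡ eq))

insertions-disjoint : ∀ {x} {ys ys′ : List ℕ} → x ∉ ys → x ∉ ys′ → ys ≢ ys′ →
                      Disjoint (insertions x ys) (insertions x ys′)
insertions-disjoint {ys = ys} {ys′} x∉ x∉′ ys≢ys′ (p , p′)
  with insertion-form ys p | insertion-form ys′ p′
... | A , C , refl , refl | A′ , C′ , refl , eq
  with ++-∷-cancel A A′ (x∉ ∘ ∈-++⁺ˡ) (x∉′ ∘ ∈-++⁺ˡ) eq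
...   | refl , refl = ys≢ys′ refl

rearrangements-unique : ∀ l → Unique l → Unique (rearrangements l)
rearrangements-unique []       _             = [] ∷ []
rearrangements-unique (x ∷ xs) (x∉xs ∷ uniq) =
  Unique.concat⁺ (each-unique (rearrangements xs) (λ p → p))
                 (pairwise-disjoint (rearrangements xs) (rearrangements-unique xs uniq) (All.tabulate x∉))
  where
  x∉ : ∀ {ys} → ys ∈ rearrangements xs → x ∉ ys
  x∉ p q = All.lookup x∉xs (∈-resp-↭ (rearrangement⇒↭ xs p) q) refl

  each-unique : ∀ R → (∀ {ys} → ys ∈ R → ys ∈ rearrangements xs) →
                All Unique (map (insertions x) R)
  each-unique []       _   = []
  each-unique (ys ∷ R) sub = insertions-unique ys (x∉ (sub (here refl))) ∷ each-unique R (sub ∘ there)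

  pairwise-disjoint : ∀ R → Unique R → All (x ∉_) R → AllPairs Disjoint (map (insertions x) R)
  pairwise-disjoint []       _              _          = []
  pairwise-disjoint (ys ∷ R) (ys∉R ∷ uniq) (x∉ys ∷ x∉R) =
    All.map⁺ (All.zipWith (λ (ys≢ , x∉′) {v} → insertions-disjoint x∉ys x∉′ ys≢ {v}) (ys∉R , x∉R))
    ∷ pairwise-disjoint R uniq x∉R

Preimage : List ℕ → List ℕ → Set
Preimage π τ = τ ↭ π × s τ ≡ π

isPreimage? : (π τ : List ℕ) → Dec (s τ ≡ π)
isPreimage? π τ = ≡-dec ℕ._≟_ (s τ) π

preimages : List ℕ → List (List ℕ)
preimages π = filter (isPreimage? π) (rearrangements π)

∈-preimages⁻ : ∀ {π τ} → τ ∈ preimages π → Preimage π τ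
∈-preimages⁻ {π} τ∈ with τ∈rearr , sτ≡π ← ∈-filter⁻ (isPreimage? π) τ∈ =
  rearrangement⇒↭ π τ∈rearr , sτ≡π

∈-preimages⁺ : ∀ {π τ} → Preimage π τ → τ ∈ preimages π
∈-preimages⁺ {π} (τ↭π , sτ≡π) =
  ∈-filter⁺ (isPreimage? π) (↭⇒rearrangement π τ↭π) sτ≡π

preimageCount-≤ : ∀ {π π′} → Unique π → (g : List ℕ → List ℕ) →
  (∀ {τ} → Preimage π τ → Preimage π′ (g τ)) →
  (∀ {τ τ′} → Preimage π τ → Preimage π τ′ → g τ ≡ g τ′ → τ ≡ τ′) →
  preimageCount π ≤ preimageCount π′
preimageCount-≤ {π} uniq g maps-to injective =
  length-≤-by-injection g (Unique.filter⁺ (isPreimage? π) (rearrangements-unique π uniq))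
    (∈-preimages⁺ ∘ maps-to ∘ ∈-preimages⁻)
    (λ τ∈ τ′∈ → injective (∈-preimages⁻ τ∈) (∈-preimages⁻ τ′∈))

data Tree : Set where
  leaf : Tree
  node : Tree → ℕ → Tree → Tree

inorder : Tree → List ℕ
inorder leaf         = []
inorder (node l v r) = inorder l ++ v ∷ inorder r

postorder : Tree → List ℕ
postorder leaf         = []
postorder (node l v r) = postorder l ++ postorder r ++ v ∷ []

Decreasing : Tree → Set
Decreasing leaf         = ⊤
Decreasing (node l v r) =
  All (_< v) (inorder l) × All (_< v) (inorder r) × Decreasing l × Decreasing r

postorder↭inorder : ∀ t → postorder t ↭ inorder t
postorder↭inorder leaf         = ↭-refl
postorder↭inorder (node l v r) =
  ++⁺ (postorder↭inorder l)
      (↭-trans (++-comm (postorder r) (v ∷ [])) (↭-prep v (postorder↭inorder r)))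

root-maximal : ∀ l v r → Decreasing (node l v r) → All (_≤ v) (inorder (node l v r))
root-maximal l v r (l<v , r<v , _) = All.++⁺ (All.map <⇒≤ l<v) (≤-refl ∷ All.map <⇒≤ r<v)

root∉left : ∀ l v r → Decreasing (node l v r) → v ∉ inorder l
root∉left l v r (l<v , _) v∈l = <-irrefl refl (All.lookup l<v v∈l)

maxL-∈ : ∀ x xs → maxL (x ∷ xs) ∈ x ∷ xs
maxL-∈ x []       rewrite ⊔-identityʳ x = here refl
maxL-∈ x (y ∷ ys) with ⊔-sel x (maxL (y ∷ ys))
... | inj₁ eq rewrite eq = here refl
... | inj₂ eq rewrite eq = there (maxL-∈ y ys)

≤-maxL : ∀ {y} l → y ∈ l → y ≤ maxL l
≤-maxL (x ∷ xs) (here refl) = m≤m⊔n x (maxL xs)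
≤-maxL (x ∷ xs) (there y∈)  = ≤-trans (≤-maxL xs y∈) (m≤n⊔m x (maxL xs))

maxL-≡ : ∀ {v} l → v ∈ l → All (_≤ v) l → maxL l ≡ v
maxL-≡ l v∈ l≤v = ≤-antisym (List.foldr-preservesᵇ ⊔-lub z≤n l≤v) (≤-maxL l v∈)

≡ᵇ-false⇒≢ : ∀ {x m} → (x ℕ.≡ᵇ m) ≡ false → x ≢ m
≡ᵇ-false⇒≢ {x} eq refl = subst T eq (≡⇒≡ᵇ x x refl)

splitAtElem-spec : ∀ m l → m ∈ l →
  l ≡ proj₁ (splitAtElem m l) ++ m ∷ proj₂ (splitAtElem m l) × m ∉ proj₁ (splitAtElem m l)
splitAtElem-spec m (x ∷ xs) m∈ with x ℕ.≡ᵇ m in eq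
... | true with refl ← ≡ᵇ⇒≡ x m (subst T (sym eq) tt) = refl , λ ()
... | false with splitAtElem m xs | splitAtElem-spec m xs (Any.tail (≡ᵇ-false⇒≢ eq ∘ sym) m∈)
...   | L , R | xs≡ , m∉L = cong (x ∷_) xs≡ , λ { (here refl) → ≡ᵇ-false⇒≢ {x} eq refl
                                                ; (there m∈L) → m∉L m∈L }

splitAtElem-++ : ∀ m L R → m ∉ L → splitAtElem m (L ++ m ∷ R) ≡ (L , R)
splitAtElem-++ m L R m∉L with splitAtElem-spec m (L ++ m ∷ R) (∈-++⁺ʳ L (here refl))
... | eq , m∉L′ with ++-∷-cancel L _ m∉L m∉L′ eq
...   | L≡ , R≡ = sym (cong₂ _,_ L≡ R≡)

sFuel-step : ∀ f L m R → m ∉ L → All (_≤ m) (L ++ m ∷ R) →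
             sFuel (suc f) (L ++ m ∷ R) ≡ sFuel f L ++ sFuel f R ++ m ∷ []
sFuel-step f []      m R m∉L bound
  rewrite maxL-≡ (m ∷ R) (here refl) bound | splitAtElem-++ m [] R m∉L = refl
sFuel-step f (a ∷ L) m R m∉L bound
  rewrite maxL-≡ (a ∷ L ++ m ∷ R) (∈-++⁺ʳ (a ∷ L) (here refl)) bound
        | splitAtElem-++ m (a ∷ L) R m∉L = refl

length-sides : ∀ f (L : List ℕ) m R → length (L ++ m ∷ R) ≤ suc f → length L ≤ f × length R ≤ f
length-sides f L m R bound rewrite List.length-++ L {m ∷ R} | +-suc (length L) (length R) =
  ≤-trans (m≤m+n (length L) (length R)) (≤-pred bound) ,
  ≤-trans (m≤n+m (length R) (length L)) (≤-pred bound)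

sFuel-inorder : ∀ f t → Decreasing t → length (inorder t) ≤ f → sFuel f (inorder t) ≡ postorder t
sFuel-inorder zero    leaf         _   _     = refl
sFuel-inorder (suc f) leaf         _   _     = refl
sFuel-inorder zero    (node l v r) _   bound
  rewrite List.length-++ (inorder l) {v ∷ inorder r} | +-suc (length (inorder l)) (length (inorder r))
  with () ← bound
sFuel-inorder (suc f) (node l v r) dec@(_ , _ , dec-l , dec-r) bound
  with length-sides f (inorder l) v (inorder r) bound
... | bound-l , bound-r =
  begin
    sFuel (suc f) (inorder l ++ v ∷ inorder r)
  ≡⟨ sFuel-step f (inorder l) v (inorder r) (root∉left l v r dec) (root-maximal l v r dec) ⟩
    sFuel f (inorder l) ++ sFuel f (inorder r) ++ v ∷ []
  ≡⟨ cong₂ (λ L R → L ++ R ++ v ∷ []) (sFuel-inorder f l dec-l bound-l) (sFuel-inorder f r dec-r bound-r) ⟩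
    postorder l ++ postorder r ++ v ∷ []
  ∎
  where open ≡-Reasoning

s-inorder : ∀ t → Decreasing t → s (inorder t) ≡ postorder t
s-inorder t dec = sFuel-inorder (length (inorder t)) t dec ≤-refl

cartesianTreeFuel : ℕ → List ℕ → Tree
cartesianTreeFuel zero    _           = leaf
cartesianTreeFuel (suc f) []          = leaf
cartesianTreeFuel (suc f) l@(_ ∷ _) =
  node (cartesianTreeFuel f (proj₁ (splitAtElem (maxL l) l)))
       (maxL l)
       (cartesianTreeFuel f (proj₂ (splitAtElem (maxL l) l)))

cartesianTree : List ℕ → Tree
cartesianTree l = cartesianTreeFuel (length l) l

cartesianTreeFuel-spec : ∀ f l → length l ≤ f → Unique l →
  inorder (cartesianTreeFuel f l) ≡ l × Decreasing (cartesianTreeFuel f l)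
cartesianTreeFuel-spec zero    []       _     _    = refl , tt
cartesianTreeFuel-spec (suc f) []       _     _    = refl , tt
cartesianTreeFuel-spec (suc f) (x ∷ xs) bound uniq
  with splitAtElem (maxL (x ∷ xs)) (x ∷ xs) | splitAtElem-spec (maxL (x ∷ xs)) (x ∷ xs) (maxL-∈ x xs)
... | L , R | l≡ , m∉L
  with length-sides f L (maxL (x ∷ xs)) R (subst (λ l → length l ≤ suc f) l≡ bound)
     | Unique-resp-↭ (shift (maxL (x ∷ xs)) L R) (subst Unique l≡ uniq)
...  | bound-L , bound-R | m∉LR ∷ uniq-LR
  with Unique-++⁻ L uniq-LR
...  | uniq-L , uniq-R
  with cartesianTreeFuel-spec f L bound-L uniq-L | cartesianTreeFuel-spec f R bound-R uniq-R
...  | in-L , dec-L | in-R , dec-R rewrite in-L | in-R =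
  sym l≡ , All.tabulate (below ∘ ∈-++⁺ˡ) , All.tabulate (below ∘ ∈-++⁺ʳ L) , dec-L , dec-R
  where
  m = maxL (x ∷ xs)
  below : ∀ {y} → y ∈ L ++ R → y < m
  below {y} y∈ = ≤∧≢⇒< (≤-maxL (x ∷ xs) (subst (y ∈_) (sym l≡) y∈l)) (λ { refl → All.lookup m∉LR y∈ refl })
    where
    y∈l : y ∈ L ++ m ∷ R
    y∈l = ∈-resp-↭ (↭-sym (shift m L R)) (there y∈)

inorder-injective : ∀ t t′ → Decreasing t → Decreasing t′ → inorder t ≡ inorder t′ → t ≡ t′
inorder-injective leaf leaf _ _ _ = refl
inorder-injective leaf (node l′ v′ r′) _ _ eq with () ← List.++-conicalʳ (inorder l′) _ (sym eq)
inorder-injective (node l v r) leaf _ _ eq with () ← List.++-conicalʳ (inorder l) _ eq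
inorder-injective (node l v r) (node l′ v′ r′) dec@(_ , _ , dec-l , dec-r) dec′@(_ , _ , dec-l′ , dec-r′) eq
  with refl ← trans (sym (maxL-≡ _ (∈-++⁺ʳ (inorder l) (here refl)) (root-maximal l v r dec)))
                    (trans (cong maxL eq) (maxL-≡ _ (∈-++⁺ʳ (inorder l′) (here refl)) (root-maximal l′ v′ r′ dec′)))
  with in-l , in-r ← ++-∷-cancel (inorder l) (inorder l′) (root∉left l v r dec) (root∉left l′ v′ r′ dec′) eq
  with refl ← inorder-injective l l′ dec-l dec-l′ in-l
  with refl ← inorder-injective r r′ dec-r dec-r′ in-r
  = refl

cartesianTree-spec : ∀ l → Unique l → inorder (cartesianTree l) ≡ l × Decreasing (cartesianTree l)
cartesianTree-spec l = cartesianTreeFuel-spec (length l) l ≤-refl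

postorders : List Tree → List ℕ
postorders []       = []
postorders (n ∷ ns) = postorder n ++ postorders ns

postorders-++ : ∀ ns ns′ → postorders (ns ++ ns′) ≡ postorders ns ++ postorders ns′
postorders-++ []       ns′ = refl
postorders-++ (n ∷ ns) ns′ = trans (cong (postorder n ++_) (postorders-++ ns ns′))
                                   (sym (List.++-assoc (postorder n) (postorders ns) _))

All-postorder : ∀ {P : ℕ → Set} t → All P (inorder t) → All P (postorder t)
All-postorder t = All-resp-↭ (↭-sym (postorder↭inorder t))

All-postorders : ∀ {P : ℕ → Set} ns → All (All P ∘ inorder) ns → All P (postorders ns)
All-postorders []       []         = []
All-postorders (n ∷ ns) (pn ∷ pns) = All.++⁺ (All-postorder n pn) (All-postorders ns pns)

postorder≡[] : ∀ t → postorder t ≡ [] → t ≡ leaf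
postorder≡[] leaf         _  = refl
postorder≡[] (node l v r) eq with () ← List.++-conicalʳ (postorder r) _ (List.++-conicalʳ (postorder l) _ eq)

single : ℕ → Tree
single v = node leaf v leaf

-- Fix a threshold x and call a tree high if its root exceeds x.  From the root
-- of a high tree follow the path that steps to the left child when it is high
-- and otherwise to the right child when that is high.  The children off this
-- path that are not high are the holes of the tree; the rest (the path itself
-- and the subtrees passed over on the right) is its frame.
module Frame (x : ℕ) where

  high : Tree → Bool
  high leaf         = false
  high (node _ v _) = x <ᵇ v

  Low : Tree → Set
  Low n = high n ≡ false

  Small : Tree → Set
  Small n = Decreasing n × All (_≤ x) (inorder n)

  holes : Tree → List Tree
  holes leaf = []
  holes (node l v r) with high l | high r
  ... | true  | _     = holes l
  ... | false | true  = l ∷ holes r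
  ... | false | false = l ∷ r ∷ []

  framePost : Tree → List ℕ
  framePost leaf = []
  framePost (node l v r) with high l | high r
  ... | true  | _     = framePost l ++ postorder r ++ v ∷ []
  ... | false | true  = framePost r ++ v ∷ []
  ... | false | false = v ∷ []

  -- Total head and tail, so that `fill` is defined on every list.
  head : List Tree → Tree
  head []      = leaf
  head (n ∷ _) = n

  tail : List Tree → List Tree
  tail []       = []
  tail (_ ∷ ns) = ns

  fill : Tree → List Tree → Tree
  fill leaf ns = leaf
  fill (node l v r) ns with high l | high r
  ... | true  | _     = node (fill l ns) v r
  ... | false | true  = node (head ns) v (fill r (tail ns))
  ... | false | false = node (head ns) v (head (tail ns))

  Fits : Tree → List Tree → Set
  Fits t ns = length ns ≡ length (holes t)

  high⇒> : ∀ {v} → (x <ᵇ v) ≡ true → x < v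
  high⇒> {v} eq = <ᵇ⇒< x v (subst T (sym eq) tt)

  >⇒high : ∀ {v} → x < v → (x <ᵇ v) ≡ true
  >⇒high x<v = Equivalence.to T-≡ (<⇒<ᵇ x<v)

  low⇒≤ : ∀ {v} → (x <ᵇ v) ≡ false → v ≤ x
  low⇒≤ eq = ≮⇒≥ (λ x<v → subst T eq (<⇒<ᵇ x<v))

  small-root≤x : ∀ {l w r} → Small (node l w r) → w ≤ x
  small-root≤x {l} (_ , bounded) = All.lookup bounded (∈-++⁺ʳ (inorder l) (here refl))

  small⇒low : ∀ {n} → Small n → Low n
  small⇒low {leaf}       _     = refl
  small⇒low {node l v r} small with x <ᵇ v in eq
  ... | false = refl
  ... | true  = ⊥-elim (<⇒≱ (high⇒> eq) (small-root≤x small))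

  low⇒small : ∀ {n} → Decreasing n → Low n → Small n
  low⇒small {leaf}       dec _   = dec , []
  low⇒small {node l v r} dec low =
    dec , All.map (λ y≤v → ≤-trans y≤v (low⇒≤ low)) (root-maximal l v r dec)

  small-below : ∀ {v n} → x < v → Small n → All (_< v) (inorder n)
  small-below x<v (_ , bounded) = All.map (λ y≤x → ≤-<-trans y≤x x<v) bounded

  high-fill : ∀ t ns → high (fill t ns) ≡ high t
  high-fill leaf         ns = refl
  high-fill (node l v r) ns with high l | high r
  ... | true  | _     = refl
  ... | false | true  = refl
  ... | false | false = refl

  fill-holes : ∀ t → fill t (holes t) ≡ t
  fill-holes leaf = refl
  fill-holes (node l v r) with high l | high r
  ... | true  | _     = cong (λ l′ → node l′ v r) (fill-holes l)
  ... | false | true  = cong (node l v) (fill-holes r)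
  ... | false | false = refl

  postorder-fill : ∀ t ns → Fits t ns → postorder (fill t ns) ≡ postorders ns ++ framePost t
  postorder-fill leaf [] _ = refl
  postorder-fill (node l v r) ns fits with high l | high r
  postorder-fill (node l v r) ns fits | true | _ =
    begin
      postorder (fill l ns) ++ postorder r ++ v ∷ []
    ≡⟨ cong (_++ _) (postorder-fill l ns fits) ⟩
      (postorders ns ++ framePost l) ++ postorder r ++ v ∷ []
    ≡⟨ List.++-assoc (postorders ns) (framePost l) _ ⟩
      postorders ns ++ framePost l ++ postorder r ++ v ∷ []
    ∎
    where open ≡-Reasoning
  postorder-fill (node l v r) (n ∷ ns) fits | false | true =
    begin
      postorder n ++ postorder (fill r ns) ++ v ∷ []
    ≡⟨ cong (λ p → postorder n ++ p ++ v ∷ []) (postorder-fill r ns (suc-injective fits)) ⟩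
      postorder n ++ (postorders ns ++ framePost r) ++ v ∷ []
    ≡⟨ cong (postorder n ++_) (List.++-assoc (postorders ns) (framePost r) _) ⟩
      postorder n ++ postorders ns ++ framePost r ++ v ∷ []
    ≡⟨ List.++-assoc (postorder n) (postorders ns) _ ⟨
      (postorder n ++ postorders ns) ++ framePost r ++ v ∷ []
    ∎
    where open ≡-Reasoning
  postorder-fill (node l v r) (n₀ ∷ n₁ ∷ []) _ | false | false
    rewrite List.++-identityʳ (postorder n₁) = sym (List.++-assoc (postorder n₀) (postorder n₁) _)
  postorder-fill (node l v r) []                () | false | true
  postorder-fill (node l v r) []                () | false | false
  postorder-fill (node l v r) (_ ∷ [])          () | false | false
  postorder-fill (node l v r) (_ ∷ _ ∷ _ ∷ _)   () | false | false

  postorder-holes : ∀ t → postorder t ≡ postorders (holes t) ++ framePost t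
  postorder-holes t = trans (cong postorder (sym (fill-holes t))) (postorder-fill t (holes t) refl)

  holes-fill : ∀ t ns → Fits t ns → All Low ns → holes (fill t ns) ≡ ns
  holes-fill leaf [] _ _ = refl
  holes-fill (node l v r) ns fits lows with high l in hl | high r in hr
  ... | true | _ rewrite high-fill l ns | hl = holes-fill l ns fits lows
  holes-fill (node l v r) (n ∷ ns) fits (low ∷ lows) | false | true
    rewrite low | high-fill r ns | hr = cong (n ∷_) (holes-fill r ns (suc-injective fits) lows)
  holes-fill (node l v r) (n₀ ∷ n₁ ∷ []) _ (low₀ ∷ low₁ ∷ []) | false | false rewrite low₀ | low₁ = refl
  holes-fill (node l v r) []              () _ | false | true
  holes-fill (node l v r) []              () _ | false | false
  holes-fill (node l v r) (_ ∷ [])        () _ | false | false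
  holes-fill (node l v r) (_ ∷ _ ∷ _ ∷ _) () _ | false | false

  fill-fill : ∀ t ns ns′ → Fits t ns → All Low ns → fill (fill t ns) ns′ ≡ fill t ns′
  fill-fill leaf [] ns′ _ _ = refl
  fill-fill (node l v r) ns ns′ fits lows with high l in hl | high r in hr
  ... | true | _ rewrite high-fill l ns | hl = cong (λ l′ → node l′ v r) (fill-fill l ns ns′ fits lows)
  fill-fill (node l v r) (n ∷ ns) ns′ fits (low ∷ lows) | false | true
    rewrite low | high-fill r ns | hr = cong (node (head ns′) v) (fill-fill r ns (tail ns′) (suc-injective fits) lows)
  fill-fill (node l v r) (n₀ ∷ n₁ ∷ []) ns′ _ (low₀ ∷ low₁ ∷ []) | false | false rewrite low₀ | low₁ = refl
  fill-fill (node l v r) []              _ () _ | false | true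
  fill-fill (node l v r) []              _ () _ | false | false
  fill-fill (node l v r) (_ ∷ [])        _ () _ | false | false
  fill-fill (node l v r) (_ ∷ _ ∷ _ ∷ _) _ () _ | false | false

  All-fill : ∀ {P : ℕ → Set} t ns → Fits t ns → All P (inorder t) → All (All P ∘ inorder) ns →
             All P (inorder (fill t ns))
  All-fill {P} t ns fits pt pns = All-resp-↭ (postorder↭inorder (fill t ns))
    (subst (All P) (sym (postorder-fill t ns fits))
      (All.++⁺ (All-postorders ns pns)
               (All.++⁻ʳ (postorders (holes t)) (subst (All P) (postorder-holes t) (All-postorder t pt)))))

  holes-small : ∀ t → high t ≡ true → Decreasing t → All Small (holes t)
  holes-small (node l v r) _ (_ , _ , dec-l , dec-r) with high l in hl | high r in hr
  ... | true  | _     = holes-small l hl dec-l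
  ... | false | true  = low⇒small dec-l hl ∷ holes-small r hr dec-r
  ... | false | false = low⇒small dec-l hl ∷ low⇒small dec-r hr ∷ []

  decreasing-fill : ∀ t ns → high t ≡ true → Decreasing t → Fits t ns → All Small ns →
                    Decreasing (fill t ns)
  decreasing-fill (node l v r) ns ht (l<v , r<v , dec-l , dec-r) fits smalls
    with high l in hl | high r in hr
  ... | true | _ =
    All-fill l ns fits l<v (All.map (small-below (high⇒> ht)) smalls) ,
    r<v , decreasing-fill l ns hl dec-l fits smalls , dec-r
  decreasing-fill (node l v r) (n ∷ ns) ht (l<v , r<v , dec-l , dec-r) fits (small ∷ smalls)
    | false | true =
    small-below (high⇒> ht) small ,
    All-fill r ns (suc-injective fits) r<v (All.map (small-below (high⇒> ht)) smalls) ,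
    proj₁ small , decreasing-fill r ns hr dec-r (suc-injective fits) smalls
  decreasing-fill (node l v r) (n₀ ∷ n₁ ∷ []) ht _ _ (small₀ ∷ small₁ ∷ []) | false | false =
    small-below (high⇒> ht) small₀ , small-below (high⇒> ht) small₁ , proj₁ small₀ , proj₁ small₁
  decreasing-fill (node l v r) []              _ _ () _ | false | true
  decreasing-fill (node l v r) []              _ _ () _ | false | false
  decreasing-fill (node l v r) (_ ∷ [])        _ _ () _ | false | false
  decreasing-fill (node l v r) (_ ∷ _ ∷ _ ∷ _) _ _ () _ | false | false

  framePost-high : ∀ t → high t ≡ true → ∃₂ λ b B → framePost t ≡ b ∷ B × x < b
  framePost-high (node l v r) ht with high l in hl | high r in hr
  ... | true | _ with framePost-high l hl
  ...   | b , B , eq , x<b rewrite eq = b , _ , refl , x<b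
  framePost-high (node l v r) ht | false | true with framePost-high r hr
  ...   | b , B , eq , x<b rewrite eq = b , _ , refl , x<b
  framePost-high (node l v r) ht | false | false = v , [] , refl , high⇒> ht

  -- A small proper tree whose postorder starts with x is the single node x:
  -- a label in a subtree would come first and lie below the root, itself ≤ x.
  small-starting-with-x : ∀ l w r after {P} → Small (node l w r) →
                          postorder (node l w r) ++ after ≡ x ∷ P → node l w r ≡ single x × after ≡ P
  small-starting-with-x l w r after small@((l<w , r<w , _) , _) eq
    with postorder l in pl | postorder r in pr
  ... | z ∷ _ | _ with refl ← List.∷-injectiveˡ eq =
    ⊥-elim (<⇒≱ (All.lookup (All-postorder l l<w) (subst (z ∈_) (sym pl) (here refl))) (small-root≤x small))
  ... | [] | z ∷ _ with refl ← List.∷-injectiveˡ eq =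
    ⊥-elim (<⇒≱ (All.lookup (All-postorder r r<w) (subst (z ∈_) (sym pr) (here refl))) (small-root≤x small))
  ... | [] | [] with refl , after≡ ← List.∷-injective eq
                 with refl ← postorder≡[] l pl | refl ← postorder≡[] r pr = refl , after≡

  leaves-then-x : ∀ ns {P} → All Small ns → postorders ns ≡ x ∷ P →
                  ∃₂ λ a Bs → ns ≡ replicate a leaf ++ single x ∷ Bs × postorders Bs ≡ P
  leaves-then-x (leaf ∷ ns) (_ ∷ smalls) eq with leaves-then-x ns smalls eq
  ... | a , Bs , refl , eq′ = suc a , Bs , refl , eq′
  leaves-then-x (node l w r ∷ ns) (small ∷ _) eq with small-starting-with-x l w r (postorders ns) small eq
  ... | refl , eq′ = 0 , ns , refl , eq′

rotateFrom : ℕ → List Tree → List Tree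
rotateFrom k []                = replicate k leaf
rotateFrom k (leaf ∷ ns)       = rotateFrom (suc k) ns
rotateFrom k (node l v r ∷ ns) = ns ++ node l v r ∷ replicate k leaf

rotateFrom-spec : ∀ a k l v r ns →
  rotateFrom k (replicate a leaf ++ node l v r ∷ ns) ≡ ns ++ node l v r ∷ replicate (a + k) leaf
rotateFrom-spec zero    k l v r ns = refl
rotateFrom-spec (suc a) k l v r ns =
  trans (rotateFrom-spec a (suc k) l v r ns) (cong (λ m → ns ++ node l v r ∷ replicate m leaf) (+-suc a k))

rotate : List Tree → List Tree
rotate = rotateFrom 0

rotate-spec : ∀ a l v r ns → rotate (replicate a leaf ++ node l v r ∷ ns) ≡ ns ++ node l v r ∷ replicate a leaf
rotate-spec a l v r ns rewrite rotateFrom-spec a 0 l v r ns | +-identityʳ a = refl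

postorders-leaves : ∀ a → postorders (replicate a leaf) ≡ []
postorders-leaves zero    = refl
postorders-leaves (suc a) = postorders-leaves a

module Move (x : ℕ) (M T : List ℕ) (M≢[] : M ≢ []) (M<x : All (_< x) M) (x<T : All (x <_) T) where
  open Frame x

  record Shape (t : Tree) : Set where
    field
      decreasing   : Decreasing t
      postorder≡   : postorder t ≡ x ∷ M ++ T
      high-root    : high t ≡ true
      leaves       : ℕ
      rest         : List Tree
      holes≡       : holes t ≡ replicate leaves leaf ++ single x ∷ rest
      postorders≡M : postorders rest ≡ M
      framePost≡T  : framePost t ≡ T

  -- The root of such a tree is the last entry of x M T and at least x, so it lies in T.
  root-high : ∀ l v r → Decreasing (node l v r) → postorder (node l v r) ≡ x ∷ M ++ T → x < v
  root-high l v r dec post =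
    [ (λ v∈M → ⊥-elim (<⇒≱ (All.lookup M<x v∈M) x≤v)) , All.lookup x<T ] (∈-++⁻ M v∈M++T)
    where
    x≤v : x ≤ v
    x≤v = All.lookup (root-maximal l v r dec)
            (∈-resp-↭ (postorder↭inorder (node l v r)) (subst (x ∈_) (sym post) (here refl)))
    v∈M++T : v ∈ M ++ T
    v∈M++T = last-∈-tail (M ++ T) (postorder l ++ postorder r)
               (trans (sym post) (sym (List.++-assoc (postorder l) (postorder r) (v ∷ []))))
               (M≢[] ∘ List.++-conicalˡ M T)

  -- In postorder, the holes carry only entries ≤ x and the frame starts above x,
  -- so the holes carry exactly x M and the frame exactly T.
  shape : ∀ t → Decreasing t → postorder t ≡ x ∷ M ++ T → Shape t
  shape t@(node l v r) dec post
    with high-t ← >⇒high (root-high l v r dec post)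
    with smalls ← holes-small t high-t dec
    with b , B , framePost≡ , x<b ← framePost-high t high-t
    with holes-post , frame≡T ←
           split-at-threshold (postorders (holes t)) (x ∷ M)
             (All-postorders (holes t) (All.map proj₂ smalls)) (≤-refl ∷ All.map <⇒≤ M<x) x<b x<T
             (trans (cong (postorders (holes t) ++_) (sym framePost≡)) (trans (sym (postorder-holes t)) post))
    with a , Bs , holes≡ , Bs≡M ← leaves-then-x (holes t) smalls holes-post
    = record
      { decreasing = dec ; postorder≡ = post ; high-root = high-t ; leaves = a ; rest = Bs
      ; holes≡ = holes≡ ; postorders≡M = Bs≡M ; framePost≡T = trans framePost≡ frame≡T }

  move : Tree → Tree
  move t = fill t (rotate (holes t))

  single-x∉ : ∀ ns → All (_< x) (postorders ns) → single x ∉ ns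
  single-x∉ (n ∷ ns) (x<x ∷ _) (here refl) = <-irrefl refl x<x
  single-x∉ (n ∷ ns) below     (there x∈)  = single-x∉ ns (All.++⁻ʳ (postorder n) below) x∈

  module _ {t : Tree} (S : Shape t) where
    open Shape S

    rotated≡ : rotate (holes t) ≡ rest ++ single x ∷ replicate leaves leaf
    rotated≡ rewrite holes≡ = rotate-spec leaves leaf x leaf rest

    holes↭rotated : holes t ↭ rotate (holes t)
    holes↭rotated rewrite rotated≡ | holes≡ =
      ↭-trans (++-comm (replicate leaves leaf) (single x ∷ rest))
              (↭-sym (shift (single x) rest (replicate leaves leaf)))

    fits : Fits t (rotate (holes t))
    fits = sym (↭-length holes↭rotated)

    rotated-small : All Small (rotate (holes t))
    rotated-small = All-resp-↭ holes↭rotated (holes-small t high-root decreasing)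

    postorder-move : postorder (move t) ≡ M ++ x ∷ T
    postorder-move =
      begin
        postorder (fill t (rotate (holes t)))
      ≡⟨ postorder-fill t _ fits ⟩
        postorders (rotate (holes t)) ++ framePost t
      ≡⟨ cong₂ _++_ (cong postorders rotated≡) framePost≡T ⟩
        postorders (rest ++ single x ∷ replicate leaves leaf) ++ T
      ≡⟨ cong (_++ T) (postorders-++ rest (single x ∷ replicate leaves leaf)) ⟩
        (postorders rest ++ x ∷ postorders (replicate leaves leaf)) ++ T
      ≡⟨ cong₂ (λ P L → (P ++ x ∷ L) ++ T) postorders≡M (postorders-leaves leaves) ⟩
        (M ++ x ∷ []) ++ T
      ≡⟨ List.++-assoc M (x ∷ []) T ⟩
        M ++ x ∷ T
      ∎
      where open ≡-Reasoning

    decreasing-move : Decreasing (move t)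
    decreasing-move = decreasing-fill t _ high-root decreasing fits rotated-small

    inorder-move : inorder (move t) ↭ inorder t
    inorder-move = begin
      inorder (move t)   ↭⟨ postorder↭inorder (move t) ⟨
      postorder (move t) ≡⟨ postorder-move ⟩
      M ++ x ∷ T         ↭⟨ shift x M T ⟩
      x ∷ M ++ T         ≡⟨ postorder≡ ⟨
      postorder t        ↭⟨ postorder↭inorder t ⟩
      inorder t          ∎
      where open PermutationReasoning

    holes-move : holes (move t) ≡ rotate (holes t)
    holes-move = holes-fill t _ fits (All.map small⇒low rotated-small)

    unmove : fill (move t) (holes t) ≡ t
    unmove = trans (fill-fill t _ (holes t) fits (All.map small⇒low rotated-small)) (fill-holes t)

    single-x∉rest : single x ∉ rest
    single-x∉rest = single-x∉ rest (subst (All (_< x)) (sym postorders≡M) M<x)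

  move-injective : ∀ {t₁ t₂} → Shape t₁ → Shape t₂ → move t₁ ≡ move t₂ → t₁ ≡ t₂
  move-injective {t₁} {t₂} S₁ S₂ eq
    with rest≡ , leaves≡ ← ++-∷-cancel (Shape.rest S₁) (Shape.rest S₂) (single-x∉rest S₁) (single-x∉rest S₂)
           (trans (sym (rotated≡ S₁)) (trans (sym (holes-move S₁)) (trans (cong holes eq)
             (trans (holes-move S₂) (rotated≡ S₂)))))
    = begin
        t₁                          ≡⟨ unmove S₁ ⟨
        fill (move t₁) (holes t₁)   ≡⟨ cong₂ fill eq same-holes ⟩
        fill (move t₂) (holes t₂)   ≡⟨ unmove S₂ ⟩
        t₂                          ∎
    where
    open ≡-Reasoning
    same-holes : holes t₁ ≡ holes t₂
    same-holes = trans (Shape.holes≡ S₁)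
      (trans (cong₂ (λ L B → L ++ single x ∷ B) leaves≡ rest≡) (sym (Shape.holes≡ S₂)))

preimageCount-x-to-middle : ∀ x (M T : List ℕ) → M ≢ [] → All (_< x) M → All (x <_) T →
  Unique (x ∷ M ++ T) → preimageCount (x ∷ M ++ T) ≤ preimageCount (M ++ x ∷ T)
preimageCount-x-to-middle x M T M≢[] M<x x<T uniq =
  preimageCount-≤ uniq g maps-to injective
  where
  open Move x M T M≢[] M<x x<T

  cartesian : ∀ {τ} → Preimage (x ∷ M ++ T) τ → inorder (cartesianTree τ) ≡ τ × Shape (cartesianTree τ)
  cartesian {τ} (τ↭π , sτ≡π) with in≡ , dec ← cartesianTree-spec τ (Unique-resp-↭ (↭-sym τ↭π) uniq) =
    in≡ , shape (cartesianTree τ) dec (trans (sym (s-inorder _ dec)) (trans (cong s in≡) sτ≡π))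

  g : List ℕ → List ℕ
  g τ = inorder (move (cartesianTree τ))

  maps-to : ∀ {τ} → Preimage (x ∷ M ++ T) τ → Preimage (M ++ x ∷ T) (g τ)
  maps-to {τ} pre@(τ↭π , _) with in≡ , S ← cartesian pre =
    (begin
       g τ                        ↭⟨ inorder-move S ⟩
       inorder (cartesianTree τ)  ≡⟨ in≡ ⟩
       τ                          ↭⟨ τ↭π ⟩
       x ∷ M ++ T                 ↭⟨ shift x M T ⟨
       M ++ x ∷ T                 ∎) ,
    trans (s-inorder _ (decreasing-move S)) (postorder-move S)
    where open PermutationReasoning

  injective : ∀ {τ τ′} → Preimage (x ∷ M ++ T) τ → Preimage (x ∷ M ++ T) τ′ → g τ ≡ g τ′ → τ ≡ τ′
  injective {τ} {τ′} pre pre′ eq with in≡ , S ← cartesian pre | in≡′ , S′ ← cartesian pre′ =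
    begin
      τ                          ≡⟨ in≡ ⟨
      inorder (cartesianTree τ)  ≡⟨ cong inorder (move-injective S S′
                                      (inorder-injective _ _ (decreasing-move S) (decreasing-move S′) eq)) ⟩
      inorder (cartesianTree τ′) ≡⟨ in≡′ ⟩
      τ′                         ∎
    where open ≡-Reasoning

below : ℕ → List ℕ → List ℕ
below a l = filter (_<? a) l

below-⊆ : ∀ {a b} l → a ≤ b → below a l ⊆ below b l
below-⊆ {a} {b} l a≤b = filter⁺ (_<? a) (_<? b) (λ { refl y<a → <-≤-trans y<a a≤b }) (⊆-refl {x = l})

rank-mono : ∀ l {a b} → a ≤ b → rank l a ≤ rank l b
rank-mono l a≤b = s≤s (length-mono-≤ (below-⊆ l a≤b))

-- If a occurs in l and a < b, then a is counted in rank l b but not in rank l a;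
-- a sublist of the same length is the whole list, so the ranks differ.
rank-strict : ∀ l {a b} → a ∈ l → a < b → rank l a < rank l b
rank-strict l {a} {b} a∈ a<b = ≤∧≢⇒< (rank-mono l (<⇒≤ a<b)) same-length⇒a<a
  where
  same-length⇒a<a : rank l a ≢ rank l b
  same-length⇒a<a eq = <-irrefl refl (proj₂ (∈-filter⁻ (_<? a) {xs = l} a∈below-a))
    where
    below-a≡below-b : below a l ≡ below b l
    below-a≡below-b = ≋⇒≡ (to-≋ (suc-injective eq) (below-⊆ l (<⇒≤ a<b)))
    a∈below-a : a ∈ below a l
    a∈below-a = subst (a ∈_) (sym below-a≡below-b) (∈-filter⁺ (_<? b) a∈ a<b)

rank-injective : ∀ l {y z} → y ∈ l → z ∈ l → rank l y ≡ rank l z → y ≡ z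
rank-injective l {y} {z} y∈ z∈ eq with <-cmp y z
... | tri< y<z _ _ = ⊥-elim (<-irrefl eq (rank-strict l y∈ y<z))
... | tri≈ _ y≡z _ = y≡z
... | tri> _ _ z<y = ⊥-elim (<-irrefl (sym eq) (rank-strict l z∈ z<y))

rank-↭ : ∀ {l l′} → l ↭ l′ → ∀ y → rank l y ≡ rank l′ y
rank-↭ p y = cong suc (↭-length (filter-↭ (_<? y) p))

range-bounds : ∀ {y} a k → y ∈ range a k → a ≤ y × y < a + k
range-bounds a (suc k) (here refl) = ≤-refl , subst (a <_) (sym (+-suc a k)) (s≤s (m≤m+n a k))
range-bounds {y} a (suc k) (there y∈) with a<y , y<1+a+k ← range-bounds (suc a) k y∈ =
  <⇒≤ a<y , subst (y <_) (sym (+-suc a k)) y<1+a+k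

∈-interval-below : ∀ {m} r → m ∈ interval 1 (r ∸ 1) → m < r
∈-interval-below {m} r m∈ with range-bounds 1 (r ∸ 1) m∈
∈-interval-below zero    _ | 1≤m , m<1 = ⊥-elim (<-irrefl refl (<-≤-trans m<1 1≤m))
∈-interval-below (suc r) _ | _   , m<r = m<r

∈-interval-above : ∀ {m} r n → m ∈ interval (suc r) n → r < m
∈-interval-above r n m∈ = proj₁ (range-bounds (suc r) (suc n ∸ suc r) m∈)

decode : ∀ n r μ π π→ → μ ≢ [] → μ ↭ interval 1 (r ∸ 1) →
  normalize π ≡ r ∷ μ ++ interval (suc r) n →
  π→ ↭ π →
  normalize π→ ≡ μ ++ r ∷ interval (suc r) n →
  ∃[ x ] ∃[ M ] ∃[ T ] π ≡ x ∷ M ++ T × π→ ≡ M ++ x ∷ T × M ≢ [] × All (_< x) M × All (x <_) T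
decode n r μ []       π→ μ≢[] μ↭ () π→↭π norm→
decode n r μ (x ∷ xs) π→ μ≢[] μ↭ norm π→↭π norm→
  with rank-x≡r , xs-ranks ← List.∷-injective norm
  with M , T , refl , M-ranks , T-ranks ← map-++-split (rank (x ∷ xs)) μ xs xs-ranks
  = x , M , T , refl , π→≡ , M≢[] , All.tabulate below-x , All.tabulate above-x
  where
  π = x ∷ M ++ T
  f = rank π

  M≢[] : M ≢ []
  M≢[] refl = μ≢[] (sym M-ranks)

  below-x : ∀ {y} → y ∈ M → y < x
  below-x {y} y∈M = ≰⇒> λ x≤y → <⇒≱ rank-y<r (subst (_≤ f y) rank-x≡r (rank-mono π x≤y))
    where
    rank-y<r : f y < r
    rank-y<r = ∈-interval-below r (∈-resp-↭ μ↭ (subst (f y ∈_) M-ranks (∈-map⁺ f y∈M)))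

  above-x : ∀ {y} → y ∈ T → x < y
  above-x {y} y∈T = ≰⇒> λ y≤x → <⇒≱ r<rank-y (subst (f y ≤_) rank-x≡r (rank-mono π y≤x))
    where
    r<rank-y : r < f y
    r<rank-y = ∈-interval-above r n (subst (f y ∈_) T-ranks (∈-map⁺ f y∈T))

  π→≡ : π→ ≡ M ++ x ∷ T
  π→≡ = map-injective-on f (rank-injective π)
          (All.tabulate (∈-resp-↭ π→↭π)) (All.tabulate (∈-resp-↭ (shift x M T)))
          (begin
             map f π→                 ≡⟨ List.map-cong (λ y → sym (rank-↭ π→↭π y)) π→ ⟩
             normalize π→             ≡⟨ norm→ ⟩
             μ ++ r ∷ interval (suc r) n
                                      ≡⟨ cong₂ _++_ M-ranks (cong₂ _∷_ rank-x≡r T-ranks) ⟨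
             map f M ++ f x ∷ map f T ≡⟨ List.map-++ f M (x ∷ T) ⟨
             map f (M ++ x ∷ T)       ∎)
    where open ≡-Reasoning

lemma3p4 : (n r : ℕ) (μ π π→ : List ℕ) →
           μ ≢ [] →
           μ ↭ interval 1 (r ∸ 1) →
           Unique π →
           normalize π ≡ r ∷ μ ++ interval (suc r) n →
           π→ ↭ π →
           normalize π→ ≡ μ ++ r ∷ interval (suc r) n →
           preimageCount π ≤ preimageCount π→
lemma3p4 n r μ π π→ μ≢[] μ↭ uniq norm π→↭π norm→
  with x , M , T , refl , refl , M≢[] , M<x , x<T ← decode n r μ π π→ μ≢[] μ↭ norm π→↭π norm→
  = preimageCount-x-to-middle x M T M≢[] M<x x<T uniq
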